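{- Let $n=4$ and consider the square board of $(n+1)\times(n+1)=5\times 5$ cells. The number of equivalence classes of closed knight paths of length $4$ on this board is exactly $3$.
   Context: Cells of an $m\times m$ board are identified with pairs $(i,j)\in\{1,\dots,m\}^2$. Two cells $(i,j),(i',j')$ are a knight's move apart if $\{|i-i'|,|j-j'|\}=\{1,2\}$. A closed knight path of length $n$ on the board is a set of $n$ distinct cells that can be listed as $c_1,\dots,c_n$ so that $c_k$ and $c_{k+1}$ are a knight's move apart for $k=1,\dots,n-1$, and $c_n$ and $c_1$ are a knight's move apart (i.e. the set can be traversed by a closed knight path visiting each of its cells exactly once). Two such sets are equivalent if one can be obtained from the other by a finite sequence of the following transformations, each keeping all cells on the board: translation (shifting every cell by one step up, down, left or right), rotation of the board by $90^\circ$, and reflection of the board (these rotations and reflections generate the dihedral group of order 8 of symmetries of the square board). -}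

module Defs where

open import Data.Nat using (ℕ; zero; suc; _∸_; _<?_; ∣_-_∣)
open import Data.Fin using (Fin; toℕ; fromℕ<)
open import Data.Product using (Σ; _×_; _,_)
open import Data.Sum using (_⊎_)
open import Data.Bool using (Bool; true)
open import Data.Maybe using (Maybe; just; nothing)
open import Relation.Nullary using (¬_; yes; no)
open import Relation.Binary.PropositionalEquality using (_≡_)
open import Relation.Binary.Construct.Closure.ReflexiveTransitive using (Star)
open import Function.Definitions using (Injective)

-- Cells of an m × m board (coordinates 0..m-1 instead of 1..m).
Cell : ℕ → Set
Cell m = Fin m × Fin m

CellSet : ℕ → Set
CellSet m = Cell m → Bool

Knight : ∀ {m} → Cell m → Cell m → Set
Knight (i , j) (i' , j') =
  (∣ toℕ i - toℕ i' ∣ ≡ 1 × ∣ toℕ j - toℕ j' ∣ ≡ 2)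
  ⊎ (∣ toℕ i - toℕ i' ∣ ≡ 2 × ∣ toℕ j - toℕ j' ∣ ≡ 1)

ClosedKnightPath : (m n : ℕ) → CellSet m → Set
ClosedKnightPath m n S =
  Σ (Fin n → Cell m) λ c →
    Injective _≡_ _≡_ c
    × (∀ (k l : Fin n) → toℕ l ≡ suc (toℕ k) → Knight (c k) (c l))
    × (∀ (k l : Fin n) → toℕ k ≡ n ∸ 1 → toℕ l ≡ 0 → Knight (c k) (c l))
    × (∀ d → S d ≡ true → Σ (Fin n) λ k → c k ≡ d)
    × (∀ k → S (c k) ≡ true)

data Move : Set where
  up down left right rot refl : Move

moveℕ : ℕ → Move → ℕ × ℕ → Maybe (ℕ × ℕ)
moveℕ m up    (a , b)     = just (suc a , b)
moveℕ m down  (zero , b)  = nothing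
moveℕ m down  (suc a , b) = just (a , b)
moveℕ m right (a , b)     = just (a , suc b)
moveℕ m left  (a , zero)  = nothing
moveℕ m left  (a , suc b) = just (a , b)
moveℕ m rot   (a , b)     = just (b , m ∸ 1 ∸ a)
moveℕ m refl  (a , b)     = just (a , m ∸ 1 ∸ b)

toCell : (m : ℕ) → ℕ × ℕ → Maybe (Cell m)
toCell m (a , b) with a <? m | b <? m
... | yes p | yes q = just (fromℕ< p , fromℕ< q)
... | _     | _     = nothing

moveCell : (m : ℕ) → Move → Cell m → Maybe (Cell m)
moveCell m mv (i , j) with moveℕ m mv (toℕ i , toℕ j)
... | just p  = toCell m p
... | nothing = nothing

Step : (m : ℕ) → CellSet m → CellSet m → Set
Step m S T = Σ Move λ mv →
    (∀ c → S c ≡ true → Σ (Cell m) λ d → moveCell m mv c ≡ just d × T d ≡ true)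
  × (∀ d → T d ≡ true → Σ (Cell m) λ c → S c ≡ true × moveCell m mv c ≡ just d)

Equivalent : (m : ℕ) → CellSet m → CellSet m → Set
Equivalent m = Star (Step m)

HasExactlyClasses : (m n k : ℕ) → Set
HasExactlyClasses m n k =
  Σ (Fin k → CellSet m) λ rep →
    (∀ i → ClosedKnightPath m n (rep i))
    × (∀ i j → Equivalent m (rep i) (rep j) → i ≡ j)
    × (∀ S → ClosedKnightPath m n S → Σ (Fin k) λ i → Equivalent m S (rep i))

-- Every transformation moves all cells by a translation, a rotation or a reflection, so it keeps
-- the unordered pair of coordinate offsets |Δi|, |Δj| between any two cells.  Hence whether a set
-- contains two cells at offsets {3,3}, or two at offsets {4,0}, is an invariant, and the three
-- representatives realise three different combinations.  Conversely a closed knight path of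
-- length 4 is a 4-cycle a → b → c → d → a of the knight graph; enumerating all such cycles on the
-- 5 × 5 board, each one is carried onto a representative by a symmetry of the board followed by a
-- translation into the corner.
module Submission where

open import Defs
open import Data.Bool using (Bool; true; T)
open import Data.Bool.Properties using (T-≡)
open import Data.Fin using (Fin; toℕ; #_)
open import Data.Fin.Patterns using (0F; 1F; 2F; 3F)
import Data.Fin.Properties as Fin
open import Data.List using (List; []; _∷_; _++_; map; replicate; upTo; foldr; tabulate; head; mapMaybe; cartesianProduct; allFin; filter)
open import Data.List.Membership.Propositional using (_∈_)
open import Data.List.Membership.Propositional.Properties using (∈-tabulate⁺; ∈-tabulate⁻; ∈-cartesianProduct⁺; ∈-allFin; ∈-filter⁺)
open import Data.List.Relation.Binary.Pointwise using (Pointwise; []; _∷_)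
open import Data.List.Relation.Unary.All using (All; all?; lookup)
open import Data.List.Relation.Unary.Any using (Any; here; there; any?)
open import Data.Maybe using (Maybe; just; nothing; _>>=_; is-just; fromMaybe; to-witness-T)
import Data.Maybe as Maybe
open import Data.Nat using (ℕ; zero; suc; _∸_; _≤_; z≤n; s≤s; ∣_-_∣; _⊓_)
import Data.Nat as ℕ
open import Data.Nat.Properties using (∣-∣-comm; m≤n⇒∣n-m∣≡n∸m; m∸n≤m; m∸[m∸n]≡n; pred[m∸n]≡m∸[1+n])
open import Data.Product using (Σ; _×_; _,_; proj₁; proj₂)
open import Data.Product.Properties using (≡-dec)
open import Data.Sum using (_⊎_; inj₁; inj₂)
open import Data.Vec using (Vec; []; _∷_)
import Data.Vec as Vec
open import Function using (case_of_; _∘_)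
open import Function.Bundles using (_⇔_; mk⇔; Equivalence)
open import Function.Construct.Composition using (_⇔-∘_)
open import Function.Construct.Identity using (⇔-id)
open import Function.Definitions using (Injective)
open import Relation.Binary.Construct.Closure.ReflexiveTransitive using (ε; _◅_)
open import Relation.Binary.Definitions using (Decidable; DecidableEquality)
open import Relation.Binary.PropositionalEquality
open import Relation.Nullary using (Dec; does; yes; no)
open import Relation.Nullary.Decidable using (⌊_⌋; toWitness; fromWitness; map′; dec⇒maybe; does-⇔; ¬?; T?; _×-dec_; _⊎-dec_; _→-dec_)

open Equivalence using (to; from)

Pointwise-∈ˡ : ∀ {A B : Set} {R : A → B → Set} {xs ys x} → Pointwise R xs ys → x ∈ xs →
               Σ B λ y → R x y × y ∈ ys
Pointwise-∈ˡ (r ∷ _) (here refl) = _ , r , here refl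
Pointwise-∈ˡ (_ ∷ rs) (there x∈xs) with Pointwise-∈ˡ rs x∈xs
... | y , r , y∈ys = y , r , there y∈ys

Pointwise-∈ʳ : ∀ {A B : Set} {R : A → B → Set} {xs ys y} → Pointwise R xs ys → y ∈ ys →
               Σ A λ x → x ∈ xs × R x y
Pointwise-∈ʳ (r ∷ _) (here refl) = _ , here refl , r
Pointwise-∈ʳ (_ ∷ rs) (there y∈ys) with Pointwise-∈ʳ rs y∈ys
... | x , x∈xs , r = x , there x∈xs , r

∣m∸n-m∸o∣≡∣n-o∣ : ∀ {m n o} → n ≤ m → o ≤ m → ∣ m ∸ n - m ∸ o ∣ ≡ ∣ n - o ∣
∣m∸n-m∸o∣≡∣n-o∣ {m} {zero} {o} _ o≤m = trans (m≤n⇒∣n-m∣≡n∸m (m∸n≤m m o)) (m∸[m∸n]≡n o≤m)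
∣m∸n-m∸o∣≡∣n-o∣ {m} {suc n} {zero} n≤m _ =
  trans (∣-∣-comm (m ∸ suc n) m) (∣m∸n-m∸o∣≡∣n-o∣ {m} {zero} z≤n n≤m)
∣m∸n-m∸o∣≡∣n-o∣ {suc m} {suc n} {suc o} (s≤s n≤m) (s≤s o≤m) = ∣m∸n-m∸o∣≡∣n-o∣ n≤m o≤m

Point : Set
Point = ℕ × ℕ

DisplacedBy : ℕ → ℕ → Point → Point → Set
DisplacedBy x y (a , b) (a' , b') =
  (∣ a - a' ∣ ≡ x × ∣ b - b' ∣ ≡ y) ⊎ (∣ a - a' ∣ ≡ y × ∣ b - b' ∣ ≡ x)

SameOffsets : Point → Point → Point → Point → Set
SameOffsets (a , b) (c , d) (a' , b') (c' , d') =
  (∣ a' - c' ∣ ≡ ∣ a - c ∣ × ∣ b' - d' ∣ ≡ ∣ b - d ∣)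
  ⊎ (∣ a' - c' ∣ ≡ ∣ b - d ∣ × ∣ b' - d' ∣ ≡ ∣ a - c ∣)

sameOffsets-sym : ∀ p q p' q' → SameOffsets p q p' q' → SameOffsets p' q' p q
sameOffsets-sym _ _ _ _ (inj₁ (e , f)) = inj₁ (sym e , sym f)
sameOffsets-sym _ _ _ _ (inj₂ (e , f)) = inj₂ (sym f , sym e)

sameOffsets-transport : ∀ p q p' q' {x y} → SameOffsets p q p' q' → DisplacedBy x y p q → DisplacedBy x y p' q'
sameOffsets-transport _ _ _ _ (inj₁ (e , f)) (inj₁ (g , h)) = inj₁ (trans e g , trans f h)
sameOffsets-transport _ _ _ _ (inj₁ (e , f)) (inj₂ (g , h)) = inj₂ (trans e g , trans f h)
sameOffsets-transport _ _ _ _ (inj₂ (e , f)) (inj₁ (g , h)) = inj₂ (trans e h , trans f g)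
sameOffsets-transport _ _ _ _ (inj₂ (e , f)) (inj₂ (g , h)) = inj₁ (trans e h , trans f g)

sameOffsets⇒displacedBy⇔ : ∀ p q p' q' {x y} → SameOffsets p q p' q' →
                           DisplacedBy x y p q ⇔ DisplacedBy x y p' q'
sameOffsets⇒displacedBy⇔ p q p' q' o =
  mk⇔ (sameOffsets-transport p q p' q' o) (sameOffsets-transport p' q' p q (sameOffsets-sym p q p' q' o))

module _ {m : ℕ} where

  coords : Cell m → Point
  coords (i , j) = toℕ i , toℕ j

  Displaced : ℕ → ℕ → Cell m → Cell m → Set
  Displaced x y c d = DisplacedBy x y (coords c) (coords d)

  OnBoard : Point → Set
  OnBoard (a , b) = a ≤ m ∸ 1 × b ≤ m ∸ 1

  coords-onBoard : ∀ c → OnBoard (coords c)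
  coords-onBoard (i , j) = bound i , bound j
    where
    bound : (k : Fin m) → toℕ k ≤ m ∸ 1
    bound k = subst (toℕ k ≤_) (pred[m∸n]≡m∸[1+n] m 0) (Fin.toℕ≤pred[n] k)

  moveℕ-sameOffsets : ∀ mv {p q p' q'} → OnBoard p → OnBoard q →
                      moveℕ m mv p ≡ just p' → moveℕ m mv q ≡ just q' → SameOffsets p q p' q'
  moveℕ-sameOffsets up    _ _ refl refl = inj₁ (refl , refl)
  moveℕ-sameOffsets right _ _ refl refl = inj₁ (refl , refl)
  moveℕ-sameOffsets down {suc a , b} {suc c , d} _ _ refl refl = inj₁ (refl , refl)
  moveℕ-sameOffsets left {a , suc b} {c , suc d} _ _ refl refl = inj₁ (refl , refl)
  moveℕ-sameOffsets rot  (a≤ , _) (c≤ , _) refl refl = inj₂ (refl , ∣m∸n-m∸o∣≡∣n-o∣ a≤ c≤)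
  moveℕ-sameOffsets refl (_ , b≤) (_ , d≤) refl refl = inj₁ (refl , ∣m∸n-m∸o∣≡∣n-o∣ b≤ d≤)
  moveℕ-sameOffsets down {zero , _} _ _ () _
  moveℕ-sameOffsets down {suc _ , _} {zero , _} _ _ _ ()
  moveℕ-sameOffsets left {_ , zero} _ _ () _
  moveℕ-sameOffsets left {_ , suc _} {_ , zero} _ _ _ ()

  toCell-coords : ∀ p {c} → toCell m p ≡ just c → coords c ≡ p
  toCell-coords (a , b) eq with a ℕ.<? m | b ℕ.<? m
  toCell-coords (a , b) refl | yes a<m | yes b<m = cong₂ _,_ (Fin.toℕ-fromℕ< a<m) (Fin.toℕ-fromℕ< b<m)
  toCell-coords (a , b) () | yes _ | no _
  toCell-coords (a , b) () | no _ | _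

  moveCell-coords : ∀ mv c {c'} → moveCell m mv c ≡ just c' → moveℕ m mv (coords c) ≡ just (coords c')
  moveCell-coords mv (i , j) eq with moveℕ m mv (toℕ i , toℕ j)
  moveCell-coords mv (i , j) eq | just p = cong just (sym (toCell-coords p eq))
  moveCell-coords mv (i , j) () | nothing

  moveCell-sameOffsets : ∀ mv {c d c' d'} → moveCell m mv c ≡ just c' → moveCell m mv d ≡ just d' →
                         SameOffsets (coords c) (coords d) (coords c') (coords d')
  moveCell-sameOffsets mv {c} {d} ec ed =
    moveℕ-sameOffsets mv (coords-onBoard c) (coords-onBoard d) (moveCell-coords mv c ec) (moveCell-coords mv d ed)

  moveCell-preserves-displaced : ∀ mv {x y c d c' d'} → moveCell m mv c ≡ just c' → moveCell m mv d ≡ just d' →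
                                 Displaced x y c d ⇔ Displaced x y c' d'
  moveCell-preserves-displaced mv {c = c} {d} {c'} {d'} ec ed =
    sameOffsets⇒displacedBy⇔ (coords c) (coords d) (coords c') (coords d') (moveCell-sameOffsets mv ec ed)

  HasDisplacedPair : ℕ → ℕ → CellSet m → Set
  HasDisplacedPair x y S = Σ (Cell m) λ c → Σ (Cell m) λ d → S c ≡ true × S d ≡ true × Displaced x y c d

  step-preserves-displacedPair : ∀ {x y S T} → Step m S T → HasDisplacedPair x y S → HasDisplacedPair x y T
  step-preserves-displacedPair (mv , forth , _) (c , d , Sc , Sd , disp)
    with forth c Sc | forth d Sd
  ... | c' , ec , Tc' | d' , ed , Td' = c' , d' , Tc' , Td' , to (moveCell-preserves-displaced mv ec ed) disp

  step-reflects-displacedPair : ∀ {x y S T} → Step m S T → HasDisplacedPair x y T → HasDisplacedPair x y S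
  step-reflects-displacedPair (mv , _ , back) (c' , d' , Tc' , Td' , disp)
    with back c' Tc' | back d' Td'
  ... | c , Sc , ec | d , Sd , ed = c , d , Sc , Sd , from (moveCell-preserves-displaced mv ec ed) disp

  equivalent-preserves-displacedPair : ∀ {x y S T} → Equivalent m S T →
                                       HasDisplacedPair x y S ⇔ HasDisplacedPair x y T
  equivalent-preserves-displacedPair ε = ⇔-id _
  equivalent-preserves-displacedPair (st ◅ sts) =
    equivalent-preserves-displacedPair sts
      ⇔-∘ mk⇔ (step-preserves-displacedPair st) (step-reflects-displacedPair st)

  _≟_ : DecidableEquality (Cell m)
  _≟_ = ≡-dec Fin._≟_ Fin._≟_

  open import Data.List.Membership.DecPropositional _≟_ using (_∈?_; find; lose)
  open import Data.List.Relation.Binary.Subset.DecPropositional _≟_ using (_⊆_; _⊆?_)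

  Enumerates : CellSet m → List (Cell m) → Set
  Enumerates S X = (∀ c → S c ≡ true → c ∈ X) × (∀ c → c ∈ X → S c ≡ true)

  enumerates-⊆ : ∀ {S X Y} → Enumerates S X → X ⊆ Y → Y ⊆ X → Enumerates S Y
  enumerates-⊆ (S⊆X , X⊆S) X⊆Y Y⊆X = (λ c Sc → X⊆Y (S⊆X c Sc)) , (λ c c∈Y → X⊆S c (Y⊆X c∈Y))

  enumerates-tabulate : ∀ {n S} {c : Fin n → Cell m} →
                        (∀ d → S d ≡ true → Σ (Fin n) λ k → c k ≡ d) → (∀ k → S (c k) ≡ true) →
                        Enumerates S (tabulate c)
  enumerates-tabulate {c = c} covered contained =
      (λ d Sd → case covered d Sd of λ { (k , refl) → ∈-tabulate⁺ k })
    , (λ d d∈ → case ∈-tabulate⁻ d∈ of λ { (k , refl) → contained k })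

  fromList : List (Cell m) → CellSet m
  fromList X c = ⌊ c ∈? X ⌋

  fromList-enumerates : ∀ X → Enumerates (fromList X) X
  fromList-enumerates X = (λ c → toWitness ∘ from T-≡) , (λ c → to T-≡ ∘ fromWitness)

  moveAll : Move → List (Cell m) → Maybe (List (Cell m))
  moveAll mv [] = just []
  moveAll mv (c ∷ X) with moveCell m mv c | moveAll mv X
  ... | just d | just Y = just (d ∷ Y)
  ... | _      | _      = nothing

  MovesTo : Move → Cell m → Cell m → Set
  MovesTo mv c d = moveCell m mv c ≡ just d

  moveAll-pointwise : ∀ mv X {Y} → moveAll mv X ≡ just Y → Pointwise (MovesTo mv) X Y
  moveAll-pointwise mv [] refl = []
  moveAll-pointwise mv (c ∷ X) eq with moveCell m mv c in ec | moveAll mv X in eX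
  moveAll-pointwise mv (c ∷ X) refl | just d | just Y = ec ∷ moveAll-pointwise mv X eX
  moveAll-pointwise mv (c ∷ X) () | just _ | nothing
  moveAll-pointwise mv (c ∷ X) () | nothing | _

  moveAll-step : ∀ {mv S T X Y} → Enumerates S X → moveAll mv X ≡ just Y → Enumerates T Y → Step m S T
  moveAll-step {mv} {S} {T} {X} {Y} (S⊆X , X⊆S) eq (T⊆Y , Y⊆T) = mv , forth , back
    where
    moved : Pointwise (MovesTo mv) X Y
    moved = moveAll-pointwise mv X eq
    forth : ∀ c → S c ≡ true → Σ (Cell m) λ d → MovesTo mv c d × T d ≡ true
    forth c Sc with Pointwise-∈ˡ moved (S⊆X c Sc)
    ... | d , e , d∈Y = d , e , Y⊆T d d∈Y
    back : ∀ d → T d ≡ true → Σ (Cell m) λ c → S c ≡ true × MovesTo mv c d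
    back d Td with Pointwise-∈ʳ moved (T⊆Y d Td)
    ... | c , c∈X , e = c , X⊆S c c∈X , e

  act : List Move → List (Cell m) → Maybe (List (Cell m))
  act []        X = just X
  act (mv ∷ ms) X = moveAll mv X >>= act ms

  act-equivalent : ∀ mv ms {S T X Y} → Enumerates S X → act (mv ∷ ms) X ≡ just Y → Enumerates T Y → Equivalent m S T
  act-equivalent mv ms {X = X} enumS eq enumT with moveAll mv X in eX
  act-equivalent mv []         enumS refl enumT | just X' = moveAll-step enumS eX enumT ◅ ε
  act-equivalent mv (mv' ∷ ms) enumS eq   enumT | just X' =
    moveAll-step enumS eX (fromList-enumerates X') ◅ act-equivalent mv' ms (fromList-enumerates X') eq enumT

  Reaches : List (Cell m) → List (Cell m) → Set
  Reaches X Z = Σ Move λ mv → Σ (List Move) λ ms → Σ (List (Cell m)) λ Y →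
                act (mv ∷ ms) X ≡ just Y × Y ⊆ Z × Z ⊆ Y

  reaches-equivalent : ∀ {S T X Z} → Enumerates S X → Reaches X Z → Enumerates T Z → Equivalent m S T
  reaches-equivalent enumS (mv , ms , Y , eq , Y⊆Z , Z⊆Y) enumT =
    act-equivalent mv ms enumS eq (enumerates-⊆ enumT Z⊆Y Y⊆Z)

  reach? : ∀ mv ms X Z → Maybe (Reaches X Z)
  reach? mv ms X Z with act (mv ∷ ms) X in eq
  ... | nothing = nothing
  ... | just Y  = Maybe.map (λ inclusions → mv , ms , Y , eq , inclusions) (dec⇒maybe (Y ⊆? Z ×-dec Z ⊆? Y))

  displaced? : ∀ x y → Decidable (Displaced x y)
  displaced? x y (i , j) (i' , j') =
    (∣ toℕ i - toℕ i' ∣ ℕ.≟ x ×-dec ∣ toℕ j - toℕ j' ∣ ℕ.≟ y) ⊎-dec (∣ toℕ i - toℕ i' ∣ ℕ.≟ y ×-dec ∣ toℕ j - toℕ j' ∣ ℕ.≟ x)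

  knight? : Decidable (Knight {m})
  knight? = displaced? 1 2

  KnightCycle : ∀ {n} → (Fin n → Cell m) → Set
  KnightCycle {n} c = Injective _≡_ _≡_ c
                    × (∀ k l → toℕ l ≡ suc (toℕ k) → Knight (c k) (c l))
                    × (∀ k l → toℕ k ≡ n ∸ 1 → toℕ l ≡ 0 → Knight (c k) (c l))

  knightCycle? : ∀ {n} (c : Fin n → Cell m) → Dec (KnightCycle c)
  knightCycle? {n} c = injective? ×-dec successive? ×-dec closing?
    where
    injective? : Dec (Injective _≡_ _≡_ c)
    injective? = map′ (λ inj {k} {l} → inj k l) (λ inj k l → inj)
                      (Fin.all? λ k → Fin.all? λ l → c k ≟ c l →-dec k Fin.≟ l)
    successive? : Dec (∀ k l → toℕ l ≡ suc (toℕ k) → Knight (c k) (c l))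
    successive? = Fin.all? λ k → Fin.all? λ l → toℕ l ℕ.≟ suc (toℕ k) →-dec knight? (c k) (c l)
    closing? : Dec (∀ k l → toℕ k ≡ n ∸ 1 → toℕ l ≡ 0 → Knight (c k) (c l))
    closing? = Fin.all? λ k → Fin.all? λ l → toℕ k ℕ.≟ n ∸ 1 →-dec toℕ l ℕ.≟ 0 →-dec knight? (c k) (c l)

  knightCycle-closedKnightPath : ∀ {n} {c : Fin n → Cell m} → KnightCycle c → ClosedKnightPath m n (fromList (tabulate c))
  knightCycle-closedKnightPath {n} {c} (inj , successive , closing) =
    c , inj , successive , closing , covered , contained
    where
    enum : Enumerates (fromList (tabulate c)) (tabulate c)
    enum = fromList-enumerates (tabulate c)
    covered : ∀ d → fromList (tabulate c) d ≡ true → Σ (Fin n) λ k → c k ≡ d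
    covered d e with ∈-tabulate⁻ (proj₁ enum d e)
    ... | k , refl = k , refl
    contained : ∀ k → fromList (tabulate c) (c k) ≡ true
    contained k = proj₂ enum (c k) (∈-tabulate⁺ k)

  displacedPair? : ∀ x y X → Dec (HasDisplacedPair x y (fromList X))
  displacedPair? x y X = map′ fromAny toAny (any? (λ c → any? (displaced? x y c) X) X)
    where
    enum : Enumerates (fromList X) X
    enum = fromList-enumerates X
    fromAny : Any (λ c → Any (Displaced x y c) X) X → HasDisplacedPair x y (fromList X)
    fromAny pairs with find pairs
    ... | c , c∈X , partners with find partners
    ...   | d , d∈X , disp = c , d , proj₂ enum c c∈X , proj₂ enum d d∈X , disp
    toAny : HasDisplacedPair x y (fromList X) → Any (λ c → Any (Displaced x y c) X) X
    toAny (c , d , Sc , Sd , disp) = lose (proj₁ enum c Sc) (lose (proj₁ enum d Sd) disp)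

  allCells : List (Cell m)
  allCells = cartesianProduct (allFin m) (allFin m)

  ∈-allCells : ∀ c → c ∈ allCells
  ∈-allCells (i , j) = ∈-cartesianProduct⁺ (∈-allFin i) (∈-allFin j)

  neighbours : Cell m → List (Cell m)
  neighbours c = filter (knight? c) allCells

  ∈-neighbours : ∀ c d → Knight c d → d ∈ neighbours c
  ∈-neighbours c d = ∈-filter⁺ (knight? c) (∈-allCells d)

representative : Fin 3 → Vec (Cell 5) 4
representative 0F = (# 0 , # 0) ∷ (# 1 , # 2) ∷ (# 3 , # 3) ∷ (# 2 , # 1) ∷ []
representative 1F = (# 0 , # 1) ∷ (# 1 , # 3) ∷ (# 3 , # 2) ∷ (# 2 , # 0) ∷ []
representative 2F = (# 0 , # 1) ∷ (# 2 , # 2) ∷ (# 4 , # 1) ∷ (# 2 , # 0) ∷ []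

representativeCells : Fin 3 → List (Cell 5)
representativeCells i = tabulate (Vec.lookup (representative i))

representativeSet : Fin 3 → CellSet 5
representativeSet i = fromList (representativeCells i)

representative-knightCycle : ∀ i → KnightCycle (Vec.lookup (representative i))
representative-knightCycle = toWitness {a? = Fin.all? λ i → knightCycle? (Vec.lookup (representative i))} _

representativeSet-closedKnightPath : ∀ i → ClosedKnightPath 5 4 (representativeSet i)
representativeSet-closedKnightPath i = knightCycle-closedKnightPath (representative-knightCycle i)

signature : Fin 3 → Bool × Bool
signature i = does (displacedPair? 3 3 (representativeCells i)) , does (displacedPair? 4 0 (representativeCells i))

signature-injective : ∀ i j → signature i ≡ signature j → i ≡ j
signature-injective 0F 0F _ = refl
signature-injective 1F 1F _ = refl
signature-injective 2F 2F _ = refl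
signature-injective 0F 1F ()
signature-injective 0F 2F ()
signature-injective 1F 0F ()
signature-injective 1F 2F ()
signature-injective 2F 0F ()
signature-injective 2F 1F ()

representativeSets-inequivalent : ∀ i j → Equivalent 5 (representativeSet i) (representativeSet j) → i ≡ j
representativeSets-inequivalent i j e = signature-injective i j (cong₂ _,_ (invariant 3 3) (invariant 4 0))
  where
  invariant : ∀ x y → does (displacedPair? x y (representativeCells i)) ≡ does (displacedPair? x y (representativeCells j))
  invariant x y = does-⇔ (equivalent-preserves-displacedPair {x = x} {y} e) (displacedPair? x y _) (displacedPair? x y _)

boardSymmetries : List (List Move)
boardSymmetries = map rotations (upTo 4) ++ map (λ k → refl ∷ rotations k) (upTo 4)
  where
  rotations : ℕ → List Move
  rotations k = replicate k rot

toCorner : List (Cell 5) → List Move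
toCorner X = replicate (least proj₁) down ++ replicate (least proj₂) left
  where
  least : (Cell 5 → Fin 5) → ℕ
  least coordinate = foldr (λ c → toℕ (coordinate c) ⊓_) 5 X

-- A 4-cycle equivalent to a representative is carried onto it by a symmetry of the board
-- followed by a translation to the lower left corner, where all representatives lie.
candidateWords : List (Cell 5) → List (List Move)
candidateWords X = map (λ g → g ++ toCorner (fromMaybe [] (act g X))) boardSymmetries

Classification : List (Cell 5) → Set
Classification X = Σ (Fin 3) λ i → Reaches X (representativeCells i)

classify? : ∀ X → Maybe (Classification X)
classify? X = head (mapMaybe attempt (cartesianProduct (allFin 3) (candidateWords X)))
  where
  attempt : Fin 3 × List Move → Maybe (Classification X)
  -- Reflecting twice is the identity; it makes every word non-empty, as Equivalent relates
  -- functions and the empty word would need S and T to be definitionally the same.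
  attempt (i , w) = Maybe.map (i ,_) (reach? refl (refl ∷ w) X (representativeCells i))

ClassifiableCycle : Cell 5 → Cell 5 → Cell 5 → Cell 5 → Set
ClassifiableCycle a b c d = Knight d a → a ≢ c → b ≢ d → T (is-just (classify? (a ∷ b ∷ c ∷ d ∷ [])))

knightCycles-classifiable :
  All (λ a → All (λ b → All (λ c → All (ClassifiableCycle a b c) (neighbours c)) (neighbours b)) (neighbours a)) allCells
knightCycles-classifiable =
  toWitness {a? = all? (λ a → all? (λ b → all? (λ c → all? (classifiable? a b c) (neighbours c))
                                                (neighbours b)) (neighbours a)) allCells} _
  where
  classifiable? : ∀ a b c d → Dec (ClassifiableCycle a b c d)
  classifiable? a b c d = knight? d a →-dec ¬? (a ≟ c) →-dec ¬? (b ≟ d) →-dec T? _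

knightCycle-classification : ∀ a b c d → Knight a b → Knight b c → Knight c d → Knight d a → a ≢ c → b ≢ d →
                             Classification (a ∷ b ∷ c ∷ d ∷ [])
knightCycle-classification a b c d ab bc cd da a≢c b≢d =
  to-witness-T (classify? (a ∷ b ∷ c ∷ d ∷ [])) (classifiable da a≢c b≢d)
  where
  classifiable : ClassifiableCycle a b c d
  classifiable = lookup (lookup (lookup (lookup knightCycles-classifiable (∈-allCells a))
                                        (∈-neighbours a b ab)) (∈-neighbours b c bc)) (∈-neighbours c d cd)

classification-equivalent : ∀ {S X} → Enumerates S X → Classification X →
                            Σ (Fin 3) λ i → Equivalent 5 S (representativeSet i)
classification-equivalent enumS (i , reaches) =
  i , reaches-equivalent enumS reaches (fromList-enumerates (representativeCells i))

closedKnightPath-classification : ∀ {S} → ClosedKnightPath 5 4 S → Σ (Fin 3) λ i → Equivalent 5 S (representativeSet i)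
closedKnightPath-classification (c , inj , successive , closing , covered , contained) =
  classification-equivalent (enumerates-tabulate {c = c} covered contained)
    (knightCycle-classification _ _ _ _
      (successive 0F 1F refl) (successive 1F 2F refl) (successive 2F 3F refl) (closing 3F 0F refl refl)
      (distinct λ ()) (distinct λ ()))
  where
  distinct : ∀ {k l} → k ≢ l → c k ≢ c l
  distinct k≢l = k≢l ∘ inj

mainTheorem1 : HasExactlyClasses 5 4 3
mainTheorem1 = representativeSet , representativeSet-closedKnightPath , representativeSets-inequivalent , λ _ → closedKnightPath-classification
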